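{- Let $G$ be a finite graph, let $c\in\mathbb{R}$ and let $r\ge 3$ be an integer. Let $V_0,V_1\subseteq V(G)$ be disjoint nonempty sets such that any two vertices of $V_0$ are clones in $G$, any two vertices of $V_1$ are clones in $G$, and $V_0\cup V_1$ is an independent set in $G$. Then $$h_{r,c}(G)\ \ge\ \min\{h_{r,c}(G[V_0\to V_1]),\ h_{r,c}(G[V_1\to V_0])\}.$$
   Context: Two vertices $u,v$ of a graph $G$ are clones if $uv\notin E(G)$ and $N(u)=N(v)$. For sets $V_0,V_1$ as in the statement, $G[V_0\to V_1]$ is the graph on vertex set $V(G)$ whose edge set is $\{xy\in E(G): x,y\notin V_0\cup V_1\}\cup\{xy: x\in V_0\cup V_1,\ y\notin V_0\cup V_1,\ zy\in E(G)\}$, where $z$ is an arbitrary fixed vertex of $V_1$ (so every vertex of $V_0\cup V_1$ receives the neighbourhood of a vertex of $V_1$, and $V_0\cup V_1$ remains independent); $G[V_1\to V_0]$ is defined symmetrically. A fractional $r$-clique packing of $G$ is a map $f:\mathcal{K}_r(G)\to\mathbb{R}_{\ge0}$ on the set $\mathcal{K}_r(G)$ of $r$-cliques of $G$ such that $\sum_{K\in\mathcal{K}_r(G),\,e\in E(K)}f(K)\le1$ for every edge $e$; $\nu_r^*(G)$ is the maximum of $\sum_K f(K)$ over such $f$. Finally $h_{r,c}(G):=\nu_r^*(G)+c\cdot e(G)$, where $e(G)$ is the number of edges.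
   Formalization: The parameter c and the values of every fractional r-clique packing are rational rather than real. -}

module Defs where

open import Data.Bool using (Bool; true; false; if_then_else_; _∧_; _∨_; not)
open import Data.Nat using (ℕ; zero; suc)
open import Data.Fin using (Fin)
import Data.Fin as F
open import Data.Fin.Subset using (Subset; ∣_∣; _∈_; _∉_; _∪_; Nonempty)
open import Data.Vec using (Vec; []; _∷_; lookup)
open import Data.List using (List; []; _∷_; map; _++_; allFin; concatMap; foldr)
open import Data.Integer using (+_)
open import Data.Nat.ListAction using () renaming (sum to sumℕ)
open import Data.Rational using (ℚ; 0ℚ; 1ℚ; _+_; _*_; _≤_; _/_)
open import Data.Product using (Σ; _×_; ∃)
open import Relation.Binary.PropositionalEquality using (_≡_; _≢_)
open import Relation.Nullary using (¬_; Dec; yes; no)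

Adj : ℕ → Set
Adj n = Fin n → Fin n → Bool

IsSimpleGraph : ∀ {n} → Adj n → Set
IsSimpleGraph {n} G = (∀ x y → G x y ≡ G y x) × (∀ x → G x x ≡ false)

allSubsets : ∀ n → List (Subset n)
allSubsets zero = [] ∷ []
allSubsets (suc n) = map (true ∷_) (allSubsets n) ++ map (false ∷_) (allSubsets n)

sumℚ : List ℚ → ℚ
sumℚ = foldr _+_ 0ℚ

ℕtoℚ : ℕ → ℚ
ℕtoℚ k = (+ k) / 1

b2ℕ : Bool → ℕ
b2ℕ true = 1
b2ℕ false = 0

lt : ∀ {n} → Fin n → Fin n → Bool
lt x y with x F.<? y
... | yes _ = true
... | no _ = false

edgeCount : ∀ {n} → Adj n → ℕ
edgeCount {n} G =
  sumℕ (concatMap (λ x → map (λ y → b2ℕ (lt x y ∧ G x y)) (allFin n)) (allFin n))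

IsClique : ∀ {n} → Adj n → ℕ → Subset n → Set
IsClique G r S = (∣ S ∣ ≡ r) × (∀ x y → x ∈ S → y ∈ S → x ≢ y → G x y ≡ true)

edgeLoad : ∀ {n} → (Subset n → ℚ) → Fin n → Fin n → ℚ
edgeLoad {n} f x y =
  sumℚ (map (λ S → if lookup S x ∧ lookup S y then f S else 0ℚ) (allSubsets n))

-- Fractional r-clique packing: a nonnegative function on the r-cliques of G
-- (encoded as a function on all subsets vanishing outside K_r(G)) such that
-- the total weight of cliques through each edge is at most 1.
IsFracPacking : ∀ {n} → Adj n → ℕ → (Subset n → ℚ) → Set
IsFracPacking {n} G r f =
  (∀ S → 0ℚ ≤ f S) ×
  (∀ S → f S ≢ 0ℚ → IsClique G r S) ×
  (∀ x y → x ≢ y → G x y ≡ true → edgeLoad f x y ≤ 1ℚ)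

packingValue : ∀ {n} → (Subset n → ℚ) → ℚ
packingValue {n} f = sumℚ (map f (allSubsets n))

IsNuStar : ∀ {n} → Adj n → ℕ → ℚ → Set
IsNuStar G r v =
  (Σ _ λ f → IsFracPacking G r f × packingValue f ≡ v) ×
  (∀ f → IsFracPacking G r f → packingValue f ≤ v)

-- h_{r,c}(G) = ν*_r(G) + c·e(G), given the value ν of ν*_r(G)
h : ∀ {n} → Adj n → ℚ → ℚ → ℚ
h G c ν = ν + c * ℕtoℚ (edgeCount G)

Clones : ∀ {n} → Adj n → Fin n → Fin n → Set
Clones {n} G u v = (G u v ≡ false) × (∀ w → G u w ≡ G v w)

-- G[W] with W = V0 ∪ V1 given the neighbourhood of z:
-- edges inside V(G)∖W kept; x ∈ W, y ∉ W adjacent iff zy ∈ E(G); W independent.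
transfer : ∀ {n} → Adj n → Subset n → Fin n → Adj n
transfer G W z x y with lookup W x | lookup W y
... | false | false = G x y
... | true  | false = G z y
... | false | true  = G x z
... | true  | true  = false

module Submission where

-- Let a = |V₀|, b = |V₁|, W = V₀ ∪ V₁, and let f₀₁, f₁₀ be optimal packings of G[V₀→V₁]
-- and G[V₁→V₀].  W is independent in both graphs, so a clique carrying weight meets W in at
-- most one vertex x, and exchanging x for any v ∈ V₁ turns a clique of G[V₀→V₁] into a
-- clique of G.  Keep the cliques of f₀₁ avoiding W with weight b and copy each clique through
-- W onto every vertex of V₁; do the same with f₁₀ and V₀, and add.  An edge avoiding W then
-- carries b·load(f₀₁) + a·load(f₁₀) ≤ a + b, and an edge from p ∈ W to the outside carries at
-- most 1 for each x ∈ W whose cliques were moved onto p, so at most a + b.  Scaling by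
-- 1/(a+b) gives a packing of G of value (b·ν₀₁ + a·ν₁₀)/(a+b).  Counting edges gives
-- (a+b)·e(G) = b·e(G[V₀→V₁]) + a·e(G[V₁→V₀]), hence
-- (a+b)·h(G) ≥ b·h(G[V₀→V₁]) + a·h(G[V₁→V₀]) ≥ (a+b)·min.

open import Defs
open import Algebra.Bundles using (CommutativeMonoid)
open import Data.Bool using (Bool; true; false; if_then_else_; _∧_; _∨_; not) renaming (_≟_ to _≟ᵇ_)
open import Data.Bool.Properties using (∧-comm; ∧-conicalˡ; ∨-zeroʳ; not-injective)
open import Data.Empty using (⊥-elim)
open import Data.Fin using (Fin)
import Data.Fin as F
import Data.Fin.Properties as FP
open import Data.Fin.Subset using (Subset; _∈_; _∉_; _∪_; _∩_; Nonempty; ∣_∣)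
open import Data.Fin.Subset.Properties using (nonempty?; x∈p∩q⁺; x∈p∩q⁻)
import Data.Integer as ℤ
import Data.Integer.Properties as ℤP
open import Data.List using (List; []; _∷_; map; _++_; allFin; concatMap)
import Data.List.Properties as LP
open import Data.Nat using (ℕ; zero; suc; _≥_)
import Data.Nat as N
import Data.Nat.Coprimality as Coprime
open import Data.Nat.ListAction using () renaming (sum to sumℕ)
open import Data.Nat.ListAction.Properties using () renaming (sum-++ to sumℕ-++)
import Data.Nat.Properties as NP
open import Data.Product using (_×_; ∃; _,_; proj₁; proj₂)
open import Data.Rational
  using (ℚ; mkℚ; 0ℚ; 1ℚ; ½; _+_; _*_; _≤_; _<_; _⊓_; 1/_; Positive; NonZero; nonNegative; positive)
import Data.Rational.Properties as QP
open import Data.Rational.Solver using (module +-*-Solver)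
open import Data.Sum using (_⊎_; inj₁; inj₂)
open import Data.Vec using ([]; _∷_; lookup; _[_]≔_)
import Data.Vec.Properties as VP
open import Function using (_∘_; _⇔_; mk⇔)
open import Relation.Binary.Definitions using (DecidableEquality; tri<; tri≈; tri>)
open import Relation.Binary.PropositionalEquality
open import Relation.Nullary using (¬_; Dec; yes; no; does)
open import Relation.Nullary.Decidable using (dec-true; does-⇔)

open import Algebra.Properties.CommutativeSemigroup
  (CommutativeMonoid.commutativeSemigroup QP.+-0-commutativeMonoid)
  using () renaming (interchange to +-interchange)

*-nonNeg : ∀ {p q} → 0ℚ ≤ p → 0ℚ ≤ q → 0ℚ ≤ p * q
*-nonNeg {p} {q} p≥0 q≥0 =
  QP.nonNegative⁻¹ _ {{QP.nonNeg*nonNeg⇒nonNeg p {{nonNegative p≥0}} q {{nonNegative q≥0}}}}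

+≢0 : ∀ p q → p + q ≢ 0ℚ → (p ≢ 0ℚ) ⊎ (q ≢ 0ℚ)
+≢0 p q p+q≢0 with p QP.≟ 0ℚ
... | no p≢0 = inj₁ p≢0
... | yes p≡0 = inj₂ (λ q≡0 → p+q≢0 (cong₂ _+_ p≡0 q≡0))

*≢0ʳ : ∀ p q → p * q ≢ 0ℚ → q ≢ 0ℚ
*≢0ʳ p q pq≢0 q≡0 = pq≢0 (trans (cong (p *_) q≡0) (QP.*-zeroʳ p))

p+p≡q+q⇒p≡q : ∀ {p q} → p + p ≡ q + q → p ≡ q
p+p≡q+q⇒p≡q {p} {q} p+p≡q+q = trans (sym (half-double p)) (trans (cong (½ *_) p+p≡q+q) (half-double q))
  where
  open +-*-Solver
  half-double : ∀ x → ½ * (x + x) ≡ x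
  half-double = solve 1 (λ x → con ½ :* (x :+ x) := x) refl

[p+q]*[x⊓y]≤p*x+q*y : ∀ {p q} → 0ℚ ≤ p → 0ℚ ≤ q → ∀ x y → (p + q) * (x ⊓ y) ≤ p * x + q * y
[p+q]*[x⊓y]≤p*x+q*y {p} {q} p≥0 q≥0 x y = QP.≤-trans (QP.≤-reflexive (QP.*-distribʳ-+ (x ⊓ y) p q))
  (QP.+-mono-≤ (QP.*-monoˡ-≤-nonNeg p {{nonNegative p≥0}} (QP.p⊓q≤p x y))
               (QP.*-monoˡ-≤-nonNeg q {{nonNegative q≥0}} (QP.p⊓q≤q x y)))

private variable A B : Set

∑ : List A → (A → ℚ) → ℚ
∑ L f = sumℚ (map f L)

syntax ∑ L (λ x → e) = ∑[ x ← L ] e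

∑-++ : ∀ (xs ys : List A) f → ∑ (xs ++ ys) f ≡ ∑ xs f + ∑ ys f
∑-++ [] ys f = sym (QP.+-identityˡ _)
∑-++ (x ∷ xs) ys f = trans (cong (f x +_) (∑-++ xs ys f)) (sym (QP.+-assoc (f x) _ _))

∑-map : ∀ (g : A → B) (L : List A) f → ∑ (map g L) f ≡ ∑ L (f ∘ g)
∑-map g L f = cong sumℚ (sym (LP.map-∘ L))

∑-cong : ∀ (L : List A) {f g : A → ℚ} → (∀ x → f x ≡ g x) → ∑ L f ≡ ∑ L g
∑-cong L f≗g = cong sumℚ (LP.map-cong f≗g L)

∑-zero : ∀ (L : List A) {f : A → ℚ} → (∀ x → f x ≡ 0ℚ) → ∑ L f ≡ 0ℚ
∑-zero [] _ = refl
∑-zero (x ∷ L) f≗0 = cong₂ _+_ (f≗0 x) (∑-zero L f≗0)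

∑-+ : ∀ (L : List A) (f g : A → ℚ) → ∑[ x ← L ] (f x + g x) ≡ ∑ L f + ∑ L g
∑-+ [] f g = refl
∑-+ (x ∷ L) f g = trans (cong (f x + g x +_) (∑-+ L f g))
  (+-interchange (f x) (g x) (∑ L f) (∑ L g))

∑-*ˡ : ∀ (L : List A) c (f : A → ℚ) → ∑[ x ← L ] (c * f x) ≡ c * ∑ L f
∑-*ˡ [] c f = sym (QP.*-zeroʳ c)
∑-*ˡ (x ∷ L) c f = trans (cong (c * f x +_) (∑-*ˡ L c f)) (sym (QP.*-distribˡ-+ c (f x) (∑ L f)))

∑-mono-≤ : ∀ (L : List A) {f g : A → ℚ} → (∀ x → f x ≤ g x) → ∑ L f ≤ ∑ L g
∑-mono-≤ [] _ = QP.≤-refl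
∑-mono-≤ (x ∷ L) f≤g = QP.+-mono-≤ (f≤g x) (∑-mono-≤ L f≤g)

∑-nonNeg : ∀ (L : List A) {f : A → ℚ} → (∀ x → 0ℚ ≤ f x) → 0ℚ ≤ ∑ L f
∑-nonNeg [] _ = QP.≤-refl
∑-nonNeg (x ∷ L) f≥0 = QP.+-mono-≤ (f≥0 x) (∑-nonNeg L f≥0)

∑-comm : ∀ (L : List A) (M : List B) (F : A → B → ℚ) →
  ∑[ a ← L ] ∑[ b ← M ] F a b ≡ ∑[ b ← M ] ∑[ a ← L ] F a b
∑-comm [] M F = sym (∑-zero M (λ _ → refl))
∑-comm (x ∷ L) M F = trans (cong (∑ M (F x) +_) (∑-comm L M F))
  (sym (∑-+ M (F x) (λ b → ∑[ a ← L ] F a b)))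

∑≢0⇒∃≢0 : ∀ (L : List A) (f : A → ℚ) → ∑ L f ≢ 0ℚ → ∃ λ x → f x ≢ 0ℚ
∑≢0⇒∃≢0 [] f ∑≢0 = ⊥-elim (∑≢0 refl)
∑≢0⇒∃≢0 (x ∷ L) f ∑≢0 with f x QP.≟ 0ℚ
... | no fx≢0 = x , fx≢0
... | yes fx≡0 = ∑≢0⇒∃≢0 L f (λ ∑≡0 → ∑≢0 (cong₂ _+_ fx≡0 ∑≡0))

ind : Bool → ℚ → ℚ
ind b q = if b then q else 0ℚ

ind-0 : ∀ b → ind b 0ℚ ≡ 0ℚ
ind-0 true = refl
ind-0 false = refl

ind-+ : ∀ b p q → ind b (p + q) ≡ ind b p + ind b q
ind-+ true p q = refl
ind-+ false p q = refl

ind-*ˡ : ∀ b c q → ind b (c * q) ≡ c * ind b q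
ind-*ˡ true c q = refl
ind-*ˡ false c q = sym (QP.*-zeroʳ c)

ind-∑ : ∀ b (L : List A) f → ind b (∑ L f) ≡ ∑[ x ← L ] ind b (f x)
ind-∑ true L f = refl
ind-∑ false L f = sym (∑-zero L (λ _ → refl))

ind-comm : ∀ a b q → ind a (ind b q) ≡ ind b (ind a q)
ind-comm true b q = refl
ind-comm false true q = refl
ind-comm false false q = refl

ind-cong : ∀ b {p q} → (b ≡ true → p ≡ q) → ind b p ≡ ind b q
ind-cong true p≡q = p≡q refl
ind-cong false _ = refl

ind-zero : ∀ b {q} → (b ≡ true → q ≡ 0ℚ) → ind b q ≡ 0ℚ
ind-zero true q≡0 = q≡0 refl
ind-zero false _ = refl

ind-mono-≤ : ∀ b {p q} → (b ≡ true → p ≤ q) → ind b p ≤ ind b q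
ind-mono-≤ true p≤q = p≤q refl
ind-mono-≤ false _ = QP.≤-refl

ind-nonNeg : ∀ b {q} → 0ℚ ≤ q → 0ℚ ≤ ind b q
ind-nonNeg true q≥0 = q≥0
ind-nonNeg false _ = QP.≤-refl

ind≢0 : ∀ b q → ind b q ≢ 0ℚ → (b ≡ true) × (q ≢ 0ℚ)
ind≢0 true q q≢0 = refl , q≢0
ind≢0 false q ind≢0 = ⊥-elim (ind≢0 refl)

ind-1 : ∀ b q → ind b q ≡ ind b 1ℚ * q
ind-1 true q = sym (QP.*-identityˡ q)
ind-1 false q = sym (QP.*-zeroˡ q)

module _ (_≟_ : DecidableEquality A) where

  -- L lists every element of A exactly once.
  Enumerates : List A → Set
  Enumerates L = ∀ a (f : A → ℚ) → ∑[ x ← L ] ind (does (x ≟ a)) (f x) ≡ f a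

  ∑-involution : ∀ L → Enumerates L → (π : A → A) → (∀ x → π (π x) ≡ x) →
    ∀ f → ∑[ x ← L ] f (π x) ≡ ∑ L f
  ∑-involution L enum π π∘π f = begin
    ∑[ x ← L ] f (π x)
      ≡⟨ ∑-cong L (λ x → sym (enum (π x) f)) ⟩
    ∑[ x ← L ] ∑[ y ← L ] ind (does (y ≟ π x)) (f y)
      ≡⟨ ∑-comm L L _ ⟩
    ∑[ y ← L ] ∑[ x ← L ] ind (does (y ≟ π x)) (f y)
      ≡⟨ ∑-cong L (λ y → ∑-cong L (λ x →
           cong (λ b → ind b (f y)) (does-⇔ (π-swap y x) (y ≟ π x) (x ≟ π y)))) ⟩
    ∑[ y ← L ] ∑[ x ← L ] ind (does (x ≟ π y)) (f y)
      ≡⟨ ∑-cong L (λ y → enum (π y) (λ _ → f y)) ⟩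
    ∑ L f ∎
    where
    open ≡-Reasoning
    π-swap : ∀ y x → (y ≡ π x) ⇔ (x ≡ π y)
    π-swap y x = mk⇔ (λ y≡πx → trans (sym (π∘π x)) (cong π (sym y≡πx)))
                     (λ x≡πy → trans (sym (π∘π y)) (cong π (sym x≡πy)))

  ∑-concentrated : ∀ L → Enumerates L → ∀ {f} a → (∀ x → x ≢ a → f x ≡ 0ℚ) → ∑ L f ≡ f a
  ∑-concentrated L enum {f} a f≡0 = trans (∑-cong L off-a) (enum a f)
    where
    off-a : ∀ x → f x ≡ ind (does (x ≟ a)) (f x)
    off-a x with x ≟ a
    ... | yes _ = refl
    ... | no x≢a = f≡0 x x≢a

  term≤∑ : ∀ L → Enumerates L → ∀ {f} → (∀ x → 0ℚ ≤ f x) → ∀ a → f a ≤ ∑ L f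
  term≤∑ L enum {f} f≥0 a = QP.≤-trans (QP.≤-reflexive (sym (enum a f)))
    (∑-mono-≤ L (λ x → ind≤ (does (x ≟ a)) (f≥0 x)))
    where
    ind≤ : ∀ b {q} → 0ℚ ≤ q → ind b q ≤ q
    ind≤ true _ = QP.≤-refl
    ind≤ false q≥0 = q≥0

∑-allFin-suc : ∀ n (f : Fin (suc n) → ℚ) → ∑ (allFin (suc n)) f ≡ f F.zero + ∑ (allFin n) (f ∘ F.suc)
∑-allFin-suc n f = cong (λ L → f F.zero + sumℚ L)
  (trans (LP.map-tabulate F.suc f) (sym (LP.map-tabulate (λ i → i) (f ∘ F.suc))))

allFin-enumerates : ∀ n → Enumerates F._≟_ (allFin n)
allFin-enumerates (suc n) F.zero f =
  trans (∑-allFin-suc n (λ x → ind (does (x F.≟ F.zero)) (f x)))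
        (trans (cong (f F.zero +_) (∑-zero (allFin n) (λ _ → refl))) (QP.+-identityʳ _))
allFin-enumerates (suc n) (F.suc a) f =
  trans (∑-allFin-suc n (λ x → ind (does (x F.≟ F.suc a)) (f x)))
        (trans (QP.+-identityˡ _) (allFin-enumerates n a (f ∘ F.suc)))

_≟ˢ_ : ∀ {n} → DecidableEquality (Subset n)
_≟ˢ_ = VP.≡-dec _≟ᵇ_

allSubsets-enumerates : ∀ n → Enumerates _≟ˢ_ (allSubsets n)
allSubsets-enumerates zero [] f = QP.+-identityʳ _
allSubsets-enumerates (suc n) (b ∷ T) f = begin
  ∑ (map (true ∷_) (allSubsets n) ++ map (false ∷_) (allSubsets n)) g
    ≡⟨ ∑-++ (map (true ∷_) (allSubsets n)) _ g ⟩
  ∑ (map (true ∷_) (allSubsets n)) g + ∑ (map (false ∷_) (allSubsets n)) g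
    ≡⟨ cong₂ _+_ (∑-map (true ∷_) (allSubsets n) g) (∑-map (false ∷_) (allSubsets n) g) ⟩
  ∑ (allSubsets n) (g ∘ (true ∷_)) + ∑ (allSubsets n) (g ∘ (false ∷_))
    ≡⟨ halves b ⟩
  f (b ∷ T) ∎
  where
  open ≡-Reasoning
  g : Subset (suc n) → ℚ
  g S = ind (does (S ≟ˢ (b ∷ T))) (f S)
  halves : ∀ b → ∑ (allSubsets n) (λ S → ind (does ((true ∷ S) ≟ˢ (b ∷ T))) (f (true ∷ S)))
               + ∑ (allSubsets n) (λ S → ind (does ((false ∷ S) ≟ˢ (b ∷ T))) (f (false ∷ S))) ≡ f (b ∷ T)
  halves true = trans (cong₂ _+_ (allSubsets-enumerates n T (f ∘ (true ∷_))) (∑-zero (allSubsets n) (λ _ → refl)))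
    (QP.+-identityʳ _)
  halves false = trans (cong₂ _+_ (∑-zero (allSubsets n) (λ _ → refl)) (allSubsets-enumerates n T (f ∘ (false ∷_))))
    (QP.+-identityˡ _)

-- Exchanging two elements of a subset

∣update∣ : ∀ {n} (S : Subset n) i b → ∣ S [ i ]≔ b ∣ N.+ b2ℕ (lookup S i) ≡ ∣ S ∣ N.+ b2ℕ b
∣update∣ (true ∷ S) F.zero true = refl
∣update∣ (true ∷ S) F.zero false = trans (NP.+-comm ∣ S ∣ 1) (sym (NP.+-identityʳ _))
∣update∣ (false ∷ S) F.zero true = trans (NP.+-identityʳ _) (NP.+-comm 1 ∣ S ∣)
∣update∣ (false ∷ S) F.zero false = refl
∣update∣ (true ∷ S) (F.suc i) b = cong suc (∣update∣ S i b)
∣update∣ (false ∷ S) (F.suc i) b = ∣update∣ S i b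

module _ {n : ℕ} where

  lookup-≢ : ∀ (S : Subset n) {a b} → lookup S a ≡ false → lookup S b ≡ true → a ≢ b
  lookup-≢ S a∉S b∈S refl with () ← trans (sym a∉S) b∈S

  lookup-injective : ∀ {S T : Subset n} → (∀ i → lookup S i ≡ lookup T i) → S ≡ T
  lookup-injective {S} {T} S≗T =
    trans (sym (VP.tabulate∘lookup S)) (trans (VP.tabulate-cong S≗T) (VP.tabulate∘lookup T))

  swap : Fin n → Fin n → Subset n → Subset n
  swap x v S = (S [ x ]≔ lookup S v) [ v ]≔ lookup S x

  lookup-swapʳ : ∀ x v S → lookup (swap x v S) v ≡ lookup S x
  lookup-swapʳ x v S = VP.lookup∘update v (S [ x ]≔ lookup S v) (lookup S x)

  lookup-update-same : ∀ x v (S : Subset n) → lookup (S [ x ]≔ lookup S v) v ≡ lookup S v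
  lookup-update-same x v S with v F.≟ x
  ... | yes refl = VP.lookup∘update v S (lookup S v)
  ... | no v≢x = VP.lookup∘update′ v≢x S (lookup S v)

  lookup-swapˡ : ∀ x v S → lookup (swap x v S) x ≡ lookup S v
  lookup-swapˡ x v S with x F.≟ v
  ... | yes refl = lookup-swapʳ x x S
  ... | no x≢v = trans (VP.lookup∘update′ x≢v (S [ x ]≔ lookup S v) (lookup S x))
                       (VP.lookup∘update x S (lookup S v))

  lookup-swap-other : ∀ x v {i} S → i ≢ x → i ≢ v → lookup (swap x v S) i ≡ lookup S i
  lookup-swap-other x v S i≢x i≢v =
    trans (VP.lookup∘update′ i≢v (S [ x ]≔ lookup S v) (lookup S x)) (VP.lookup∘update′ i≢x S (lookup S v))

  swap-involutive : ∀ x v S → swap x v (swap x v S) ≡ S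
  swap-involutive x v S = lookup-injective pointwise
    where
    pointwise : ∀ i → lookup (swap x v (swap x v S)) i ≡ lookup S i
    pointwise i with i F.≟ v | i F.≟ x
    ... | yes refl | _ = trans (lookup-swapʳ x i (swap x i S)) (lookup-swapˡ x i S)
    ... | no _ | yes refl = trans (lookup-swapˡ i v (swap i v S)) (lookup-swapʳ i v S)
    ... | no i≢v | no i≢x = trans (lookup-swap-other x v (swap x v S) i≢x i≢v) (lookup-swap-other x v S i≢x i≢v)

  ∣swap∣ : ∀ x v S → ∣ swap x v S ∣ ≡ ∣ S ∣
  ∣swap∣ x v S = NP.+-cancelʳ-≡ (b2ℕ (lookup S v)) _ _ (begin
    ∣ swap x v S ∣ N.+ b2ℕ (lookup S v)
      ≡⟨ cong (λ b → ∣ swap x v S ∣ N.+ b2ℕ b) (sym (lookup-update-same x v S)) ⟩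
    ∣ swap x v S ∣ N.+ b2ℕ (lookup T v)
      ≡⟨ ∣update∣ T v (lookup S x) ⟩
    ∣ T ∣ N.+ b2ℕ (lookup S x)
      ≡⟨ ∣update∣ S x (lookup S v) ⟩
    ∣ S ∣ N.+ b2ℕ (lookup S v) ∎)
    where
    open ≡-Reasoning
    T = S [ x ]≔ lookup S v

module _ {n : ℕ} where

  size : Subset n → ℚ
  size V = ∑[ x ← allFin n ] ind (lookup V x) 1ℚ

  size-nonNeg : ∀ V → 0ℚ ≤ size V
  size-nonNeg V = ∑-nonNeg (allFin n) (λ x → ind-nonNeg (lookup V x) (QP.nonNegative⁻¹ 1ℚ))

  ∑-ind-const : ∀ V c → ∑[ x ← allFin n ] ind (lookup V x) c ≡ size V * c
  ∑-ind-const V c = trans (∑-cong (allFin n) (λ x → trans (ind-1 (lookup V x) c) (QP.*-comm _ c)))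
    (trans (∑-*ˡ (allFin n) c _) (QP.*-comm c (size V)))

  covers : Fin n → Fin n → Subset n → Bool
  covers p q S = lookup S p ∧ lookup S q

  -- edgeLoad g p q and packingValue g are definitionally weight (covers p q) g and
  -- weight (λ _ → true) g.
  weight : (Subset n → Bool) → (Subset n → ℚ) → ℚ
  weight P g = ∑[ S ← allSubsets n ] ind (P S) (g S)

  weight-cong : ∀ P {g h} → (∀ S → P S ≡ true → g S ≡ h S) → weight P g ≡ weight P h
  weight-cong P g≗h = ∑-cong (allSubsets n) (λ S → ind-cong (P S) (g≗h S))

  weight-congˡ : ∀ {P Q} g → (∀ S → P S ≡ Q S) → weight P g ≡ weight Q g
  weight-congˡ g P≗Q = ∑-cong (allSubsets n) (λ S → cong (λ b → ind b (g S)) (P≗Q S))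

  weight-zero : ∀ P {g} → (∀ S → P S ≡ true → g S ≡ 0ℚ) → weight P g ≡ 0ℚ
  weight-zero P g≡0 = ∑-zero (allSubsets n) (λ S → ind-zero (P S) (g≡0 S))

  weight-+ : ∀ P g h → weight P (λ S → g S + h S) ≡ weight P g + weight P h
  weight-+ P g h = trans (∑-cong (allSubsets n) (λ S → ind-+ (P S) (g S) (h S))) (∑-+ (allSubsets n) _ _)

  weight-*ˡ : ∀ P c g → weight P (λ S → c * g S) ≡ c * weight P g
  weight-*ˡ P c g = trans (∑-cong (allSubsets n) (λ S → ind-*ˡ (P S) c (g S))) (∑-*ˡ (allSubsets n) c _)

  weight-∑ : ∀ P (L : List A) (F : A → Subset n → ℚ) →
    weight P (λ S → ∑[ a ← L ] F a S) ≡ ∑[ a ← L ] weight P (F a)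
  weight-∑ P L F = trans (∑-cong (allSubsets n) (λ S → ind-∑ (P S) L _)) (∑-comm (allSubsets n) L _)

  weight-ind : ∀ P b g → weight P (λ S → ind b (g S)) ≡ ind b (weight P g)
  weight-ind P b g = trans (∑-cong (allSubsets n) (λ S → ind-comm (P S) b (g S))) (sym (ind-∑ b (allSubsets n) _))

  weight-involution : ∀ P g (π : Subset n → Subset n) → (∀ S → π (π S) ≡ S) →
    weight P (g ∘ π) ≡ weight (P ∘ π) g
  weight-involution P g π π∘π = begin
    ∑[ S ← allSubsets n ] ind (P S) (g (π S))
      ≡⟨ ∑-cong (allSubsets n) (λ S → cong (λ T → ind (P T) (g (π S))) (sym (π∘π S))) ⟩
    ∑[ S ← allSubsets n ] ind (P (π (π S))) (g (π S))
      ≡⟨ ∑-involution _≟ˢ_ (allSubsets n) (allSubsets-enumerates n) π π∘π _ ⟩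
    ∑[ S ← allSubsets n ] ind (P (π S)) (g S) ∎
    where open ≡-Reasoning

meets : ∀ {n} → Subset n → Subset n → Bool
meets W S = does (nonempty? (S ∩ W))

module _ {n} (W S : Subset n) where

  meets-intro : ∀ {x} → lookup S x ≡ true → lookup W x ≡ true → meets W S ≡ true
  meets-intro {x} x∈S x∈W =
    dec-true (nonempty? (S ∩ W)) (x , x∈p∩q⁺ (VP.lookup⇒[]= x S x∈S , VP.lookup⇒[]= x W x∈W))

  meets-elim : meets W S ≡ true → ∃ λ x → lookup S x ≡ true × lookup W x ≡ true
  meets-elim S∩W≢∅ with nonempty? (S ∩ W)
  ... | yes (x , x∈S∩W) =
    x , VP.[]=⇒lookup (proj₁ (x∈p∩q⁻ S W x∈S∩W)) , VP.[]=⇒lookup (proj₂ (x∈p∩q⁻ S W x∈S∩W))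

  meets-false : meets W S ≡ false → ∀ {x} → lookup S x ≡ true → lookup W x ≡ false
  meets-false S∩W≡∅ {x} x∈S with lookup W x in x∈W
  ... | false = refl
  ... | true with () ← trans (sym (meets-intro x∈S x∈W)) S∩W≡∅

module _ {n} (G : Adj n) (W : Subset n) (z : Fin n) {x y : Fin n} where

  transfer-outside : lookup W x ≡ false → lookup W y ≡ false → transfer G W z x y ≡ G x y
  transfer-outside x∉W y∉W rewrite x∉W | y∉W = refl

  transfer-leaving : lookup W x ≡ true → lookup W y ≡ false → transfer G W z x y ≡ G z y
  transfer-leaving x∈W y∉W rewrite x∈W | y∉W = refl

  transfer-inside : lookup W x ≡ true → lookup W y ≡ true → transfer G W z x y ≡ false
  transfer-inside x∈W y∈W rewrite x∈W | y∈W = refl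

transfer-simple : ∀ {n} {G : Adj n} → IsSimpleGraph G → ∀ W z → IsSimpleGraph (transfer G W z)
transfer-simple {G = G} (G-sym , G-irrefl) W z = symmetric , irreflexive
  where
  symmetric : ∀ x y → transfer G W z x y ≡ transfer G W z y x
  symmetric x y with lookup W x | lookup W y
  ... | false | false = G-sym x y
  ... | true | false = G-sym z y
  ... | false | true = G-sym x z
  ... | true | true = refl
  irreflexive : ∀ x → transfer G W z x x ≡ false
  irreflexive x with lookup W x
  ... | true = refl
  ... | false = G-irrefl x

-- Pulling a packing of G[W → z] back to G

module TransferredPacking {n} (G : Adj n) (G-sym : ∀ x y → G x y ≡ G y x) (W : Subset n) (z : Fin n)
  {r} {f : Subset n → ℚ} (f-packing : IsFracPacking (transfer G W z) r f) where

  private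
    H : Adj n
    H = transfer G W z

    f-nonNeg : ∀ S → 0ℚ ≤ f S
    f-nonNeg = proj₁ f-packing

    f-clique : ∀ S → f S ≢ 0ℚ → IsClique H r S
    f-clique = proj₁ (proj₂ f-packing)

    f-load : ∀ x y → x ≢ y → H x y ≡ true → edgeLoad f x y ≤ 1ℚ
    f-load = proj₂ (proj₂ f-packing)

    clique-adjacent : ∀ {T a b} → f T ≢ 0ℚ → lookup T a ≡ true → lookup T b ≡ true → a ≢ b → H a b ≡ true
    clique-adjacent {T} {a} {b} fT≢0 a∈T b∈T =
      proj₂ (f-clique T fT≢0) a b (VP.lookup⇒[]= a T a∈T) (VP.lookup⇒[]= b T b∈T)

  W-once : ∀ {T x y} → f T ≢ 0ℚ → lookup T x ≡ true → lookup W x ≡ true →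
           lookup T y ≡ true → lookup W y ≡ true → x ≡ y
  W-once {T} {x} {y} fT≢0 x∈T x∈W y∈T y∈W with x F.≟ y
  ... | yes x≡y = x≡y
  ... | no x≢y with () ← trans (sym (clique-adjacent fT≢0 x∈T y∈T x≢y)) (transfer-inside G W z x∈W y∈W)

  W-twice⇒0 : ∀ {T x y} → x ≢ y → lookup T x ≡ true → lookup W x ≡ true →
              lookup T y ≡ true → lookup W y ≡ true → f T ≡ 0ℚ
  W-twice⇒0 {T} x≢y x∈T x∈W y∈T y∈W with f T QP.≟ 0ℚ
  ... | yes fT≡0 = fT≡0
  ... | no fT≢0 = ⊥-elim (x≢y (W-once fT≢0 x∈T x∈W y∈T y∈W))

  outside : Subset n → ℚ
  outside S = ind (not (meets W S)) (f S)

  through : Fin n → Subset n → ℚ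
  through x S = ind (lookup S x) (f S)

  split-at-W : ∀ S → f S ≡ outside S + ∑[ x ← allFin n ] ind (lookup W x) (through x S)
  split-at-W S with meets W S in S∩W
  ... | false = sym (trans (cong (f S +_) (∑-zero (allFin n) none)) (QP.+-identityʳ _))
    where
    none : ∀ x → ind (lookup W x) (through x S) ≡ 0ℚ
    none x with lookup S x in x∈S
    ... | false = ind-0 (lookup W x)
    ... | true = cong (λ b → ind b (f S)) (meets-false W S S∩W x∈S)
  ... | true = sym (trans (cong (0ℚ +_) (∑-concentrated F._≟_ (allFin n) (allFin-enumerates n) x₀ others))
                         (trans (QP.+-identityˡ _) only-x₀))
    where
    x₀ = proj₁ (meets-elim W S S∩W)
    x₀∈S = proj₁ (proj₂ (meets-elim W S S∩W))
    x₀∈W = proj₂ (proj₂ (meets-elim W S S∩W))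
    others : ∀ x → x ≢ x₀ → ind (lookup W x) (through x S) ≡ 0ℚ
    others x x≢x₀ = ind-zero (lookup W x) (λ x∈W → ind-zero (lookup S x) (λ x∈S →
      W-twice⇒0 x≢x₀ x∈S x∈W x₀∈S x₀∈W))
    only-x₀ : ind (lookup W x₀) (through x₀ S) ≡ f S
    only-x₀ = trans (cong (λ b → ind b (through x₀ S)) x₀∈W) (cong (λ b → ind b (f S)) x₀∈S)

  outside-meets : ∀ {S x} → lookup S x ≡ true → lookup W x ≡ true → outside S ≡ 0ℚ
  outside-meets {S} x∈S x∈W = cong (λ b → ind (not b) (f S)) (meets-intro W S x∈S x∈W)

  -- gather v puts on S the weight of every clique through some x ∈ W that becomes S when x is
  -- exchanged for v.
  gather : Fin n → Subset n → ℚ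
  gather v S = ∑[ x ← allFin n ] ind (lookup W x) (through x (swap x v S))

  weightThroughW : (Subset n → Bool) → ℚ
  weightThroughW P = ∑[ x ← allFin n ] ind (lookup W x) (weight P (through x))

  weight-split-at-W : ∀ P → weight P f ≡ weight P outside + weightThroughW P
  weight-split-at-W P = begin
    weight P f
      ≡⟨ weight-cong P (λ S _ → split-at-W S) ⟩
    weight P (λ S → outside S + ∑[ x ← allFin n ] ind (lookup W x) (through x S))
      ≡⟨ weight-+ P outside _ ⟩
    weight P outside + weight P (λ S → ∑[ x ← allFin n ] ind (lookup W x) (through x S))
      ≡⟨ cong (weight P outside +_) (trans (weight-∑ P (allFin n) _)
           (∑-cong (allFin n) (λ x → weight-ind P (lookup W x) (through x)))) ⟩
    weight P outside + weightThroughW P ∎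
    where open ≡-Reasoning

  weight-gather : ∀ P v →
    weight P (gather v) ≡ ∑[ x ← allFin n ] ind (lookup W x) (weight (P ∘ swap x v) (through x))
  weight-gather P v = trans (weight-∑ P (allFin n) _) (∑-cong (allFin n) (λ x →
    trans (weight-ind P (lookup W x) _)
          (cong (ind (lookup W x)) (weight-involution P (through x) (swap x v) (swap-involutive x v)))))

  SwapInvariant : (Subset n → Bool) → Set
  SwapInvariant P = ∀ {x v} → lookup W x ≡ true → lookup W v ≡ true → ∀ S → P (swap x v S) ≡ P S

  weight-gather-invariant : ∀ {P v} → SwapInvariant P → lookup W v ≡ true →
    weight P (gather v) ≡ weightThroughW P
  weight-gather-invariant {P} {v} P-inv v∈W = trans (weight-gather P v) (∑-cong (allFin n) (λ x →
    ind-cong (lookup W x) (λ x∈W → weight-congˡ (through x) (P-inv x∈W v∈W))))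

  outside-clique : ∀ S → outside S ≢ 0ℚ → IsClique G r S
  outside-clique S out≢0 with meets W S in S∩W
  ... | true = ⊥-elim (out≢0 refl)
  ... | false = proj₁ (f-clique S out≢0) , adjacent
    where
    adjacent : ∀ a b → a ∈ S → b ∈ S → a ≢ b → G a b ≡ true
    adjacent a b a∈S b∈S a≢b =
      trans (sym (transfer-outside G W z (meets-false W S S∩W (VP.[]=⇒lookup a∈S))
                                         (meets-false W S S∩W (VP.[]=⇒lookup b∈S))))
            (proj₂ (f-clique S out≢0) a b a∈S b∈S a≢b)

  swap-clique : ∀ {S x v} → lookup W x ≡ true → lookup W v ≡ true → (∀ y → G v y ≡ G z y) →
    lookup S v ≡ true → f (swap x v S) ≢ 0ℚ → IsClique G r S
  swap-clique {S} {x} {v} x∈W v∈W v~z v∈S fT≢0 = card , adjacent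
    where
    T = swap x v S
    x∈T : lookup T x ≡ true
    x∈T = trans (lookup-swapˡ x v S) v∈S
    card : ∣ S ∣ ≡ r
    card = trans (cong ∣_∣ (sym (swap-involutive x v S))) (trans (∣swap∣ x v T) (proj₁ (f-clique T fT≢0)))
    only-v : ∀ {u} → lookup S u ≡ true → lookup W u ≡ true → u ≡ v
    only-v {u} u∈S u∈W with u F.≟ v | u F.≟ x
    ... | yes u≡v | _ = u≡v
    ... | no _ | yes refl = sym (W-once fT≢0 (trans (lookup-swapʳ u v S) u∈S) v∈W x∈T x∈W)
    ... | no u≢v | no u≢x =
      ⊥-elim (u≢x (W-once fT≢0 (trans (lookup-swap-other x v S u≢x u≢v) u∈S) u∈W x∈T x∈W))
    stays : ∀ {b} → lookup W b ≡ false → lookup S b ≡ true → lookup T b ≡ true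
    stays b∉W b∈S = trans (lookup-swap-other x v S (lookup-≢ W b∉W x∈W) (lookup-≢ W b∉W v∈W)) b∈S
    leaving : ∀ {a b} → lookup S a ≡ true → lookup W a ≡ true → lookup S b ≡ true → lookup W b ≡ false →
      G a b ≡ true
    leaving {a} {b} a∈S a∈W b∈S b∉W = begin
      G a b  ≡⟨ cong (λ u → G u b) (only-v a∈S a∈W) ⟩
      G v b  ≡⟨ v~z b ⟩
      G z b  ≡⟨ sym (transfer-leaving G W z x∈W b∉W) ⟩
      H x b  ≡⟨ clique-adjacent fT≢0 x∈T (stays b∉W b∈S) (λ x≡b → lookup-≢ W b∉W x∈W (sym x≡b)) ⟩
      true   ∎
      where open ≡-Reasoning
    adjacent : ∀ a b → a ∈ S → b ∈ S → a ≢ b → G a b ≡ true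
    adjacent a b a∈S b∈S a≢b with lookup W a in a∈W | lookup W b in b∈W
    ... | true | true =
      ⊥-elim (a≢b (trans (only-v (VP.[]=⇒lookup a∈S) a∈W) (sym (only-v (VP.[]=⇒lookup b∈S) b∈W))))
    ... | true | false = leaving (VP.[]=⇒lookup a∈S) a∈W (VP.[]=⇒lookup b∈S) b∈W
    ... | false | true = trans (G-sym a b) (leaving (VP.[]=⇒lookup b∈S) b∈W (VP.[]=⇒lookup a∈S) a∈W)
    ... | false | false = trans (sym (transfer-outside G W z a∈W b∈W))
      (clique-adjacent fT≢0 (stays a∈W (VP.[]=⇒lookup a∈S)) (stays b∈W (VP.[]=⇒lookup b∈S)) a≢b)

  gather-clique : ∀ {v} → lookup W v ≡ true → (∀ y → G v y ≡ G z y) →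
    ∀ S → gather v S ≢ 0ℚ → IsClique G r S
  gather-clique {v} v∈W v~z S gather≢0 =
    let x , term≢0 = ∑≢0⇒∃≢0 (allFin n) _ gather≢0
        x∈W , through≢0 = ind≢0 (lookup W x) _ term≢0
        x∈T , fT≢0 = ind≢0 (lookup (swap x v S) x) _ through≢0
    in swap-clique x∈W v∈W v~z (trans (sym (lookup-swapˡ x v S)) x∈T) fT≢0

  gather-elsewhere : ∀ {p v S} → lookup W p ≡ true → lookup W v ≡ true → v ≢ p → lookup S p ≡ true →
    gather v S ≡ 0ℚ
  gather-elsewhere {p} {v} {S} p∈W v∈W v≢p p∈S = ∑-zero (allFin n) (λ x →
    ind-zero (lookup W x) (λ x∈W → ind-zero (lookup (swap x v S) x) (λ x∈T → vanishes x x∈W x∈T (x F.≟ p))))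
    where
    vanishes : ∀ x → lookup W x ≡ true → lookup (swap x v S) x ≡ true → Dec (x ≡ p) → f (swap x v S) ≡ 0ℚ
    vanishes x x∈W x∈T (yes refl) = W-twice⇒0 v≢p (trans (lookup-swapʳ x v S) p∈S) v∈W x∈T x∈W
    vanishes x x∈W x∈T (no x≢p) =
      W-twice⇒0 (x≢p ∘ sym) (trans (lookup-swap-other x v S (x≢p ∘ sym) (v≢p ∘ sym)) p∈S) p∈W x∈T x∈W

  gather-load : ∀ {v q} → lookup W v ≡ true → lookup W q ≡ false → (∀ y → G v y ≡ G z y) → G v q ≡ true →
    edgeLoad (gather v) v q ≤ size W
  gather-load {v} {q} v∈W q∉W v~z Gvq = begin
    weight (covers v q) (gather v)
      ≡⟨ weight-gather (covers v q) v ⟩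
    ∑[ x ← allFin n ] ind (lookup W x) (weight (covers v q ∘ swap x v) (through x))
      ≤⟨ ∑-mono-≤ (allFin n) (λ x → ind-mono-≤ (lookup W x) (λ x∈W → QP.≤-trans
           (QP.≤-reflexive (moved-edge x∈W)) (f-load x q (lookup-≢ W q∉W x∈W ∘ sym) (Hxq x∈W)))) ⟩
    size W ∎
    where
    open QP.≤-Reasoning
    moved-edge : ∀ {x} → lookup W x ≡ true → weight (covers v q ∘ swap x v) (through x) ≡ edgeLoad f x q
    moved-edge {x} x∈W = trans
      (weight-congˡ (through x) (λ S → cong₂ _∧_ (lookup-swapʳ x v S)
        (lookup-swap-other x v S (lookup-≢ W q∉W x∈W) (lookup-≢ W q∉W v∈W))))
      (weight-cong (covers x q) (λ S xq∈S → cong (λ b → ind b (f S)) (∧-conicalˡ _ _ xq∈S)))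
    Hxq : ∀ {x} → lookup W x ≡ true → H x q ≡ true
    Hxq x∈W = trans (transfer-leaving G W z x∈W q∉W) (trans (sym (v~z q)) Gvq)

  gather-nonNeg : ∀ v S → 0ℚ ≤ gather v S
  gather-nonNeg v S = ∑-nonNeg (allFin n) (λ x →
    ind-nonNeg (lookup W x) (ind-nonNeg (lookup (swap x v S) x) (f-nonNeg (swap x v S))))

  module Pullback (V : Subset n) (V⊆W : ∀ {v} → lookup V v ≡ true → lookup W v ≡ true)
                  (V~z : ∀ {v} → lookup V v ≡ true → ∀ y → G v y ≡ G z y) where

    pullback : Subset n → ℚ
    pullback S = size V * outside S + ∑[ v ← allFin n ] ind (lookup V v) (gather v S)

    weight-pullback-split : ∀ P → weight P pullback ≡
      size V * weight P outside + ∑[ v ← allFin n ] ind (lookup V v) (weight P (gather v))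
    weight-pullback-split P = trans (weight-+ P _ _) (cong₂ _+_ (weight-*ˡ P (size V) outside)
      (trans (weight-∑ P (allFin n) _) (∑-cong (allFin n) (λ v → weight-ind P (lookup V v) (gather v)))))

    weight-pullback : ∀ {P} → SwapInvariant P → weight P pullback ≡ size V * weight P f
    weight-pullback {P} P-inv = begin
      weight P pullback
        ≡⟨ weight-pullback-split P ⟩
      size V * weight P outside + ∑[ v ← allFin n ] ind (lookup V v) (weight P (gather v))
        ≡⟨ cong (size V * weight P outside +_) (trans (∑-cong (allFin n) (λ v →
             ind-cong (lookup V v) (λ v∈V → weight-gather-invariant P-inv (V⊆W v∈V)))) (∑-ind-const V _)) ⟩
      size V * weight P outside + size V * weightThroughW P
        ≡⟨ sym (QP.*-distribˡ-+ (size V) _ _) ⟩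
      size V * (weight P outside + weightThroughW P)
        ≡⟨ cong (size V *_) (sym (weight-split-at-W P)) ⟩
      size V * weight P f ∎
      where open ≡-Reasoning

    pullback-load : ∀ {p q} → lookup W p ≡ true → lookup W q ≡ false → G p q ≡ true →
      edgeLoad pullback p q ≤ ind (lookup V p) (size W)
    pullback-load {p} {q} p∈W q∉W Gpq = begin
      weight (covers p q) pullback
        ≡⟨ weight-pullback-split (covers p q) ⟩
      size V * weight (covers p q) outside + ∑[ v ← allFin n ] ind (lookup V v) (weight (covers p q) (gather v))
        ≡⟨ cong₂ (λ a b → size V * a + b) no-outside
             (∑-concentrated F._≟_ (allFin n) (allFin-enumerates n) p elsewhere) ⟩
      size V * 0ℚ + ind (lookup V p) (weight (covers p q) (gather p))
        ≡⟨ trans (cong (_+ ind (lookup V p) (edgeLoad (gather p) p q)) (QP.*-zeroʳ (size V))) (QP.+-identityˡ _) ⟩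
      ind (lookup V p) (edgeLoad (gather p) p q)
        ≤⟨ ind-mono-≤ (lookup V p) (λ p∈V → gather-load p∈W q∉W (V~z p∈V) Gpq) ⟩
      ind (lookup V p) (size W) ∎
      where
      open QP.≤-Reasoning
      no-outside : weight (covers p q) outside ≡ 0ℚ
      no-outside = weight-zero (covers p q) (λ S pq∈S → outside-meets (∧-conicalˡ _ _ pq∈S) p∈W)
      elsewhere : ∀ v → v ≢ p → ind (lookup V v) (weight (covers p q) (gather v)) ≡ 0ℚ
      elsewhere v v≢p = ind-zero (lookup V v) (λ v∈V → weight-zero (covers p q) (λ S pq∈S →
        gather-elsewhere p∈W (V⊆W v∈V) v≢p (∧-conicalˡ _ _ pq∈S)))

    pullback-nonNeg : ∀ S → 0ℚ ≤ pullback S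
    pullback-nonNeg S = QP.+-mono-≤ (*-nonNeg (size-nonNeg V) (ind-nonNeg (not (meets W S)) (f-nonNeg S)))
      (∑-nonNeg (allFin n) (λ v → ind-nonNeg (lookup V v) (gather-nonNeg v S)))

    pullback-clique : ∀ S → pullback S ≢ 0ℚ → IsClique G r S
    pullback-clique S pullback≢0 with +≢0 _ _ pullback≢0
    ... | inj₁ outside≢0 = outside-clique S (*≢0ʳ (size V) (outside S) outside≢0)
    ... | inj₂ gathered≢0 =
      let v , term≢0 = ∑≢0⇒∃≢0 (allFin n) _ gathered≢0
          v∈V , gather≢0 = ind≢0 (lookup V v) _ term≢0
      in gather-clique (V⊆W v∈V) (V~z v∈V) S gather≢0

module Scaled {n} (G : Adj n) (r : ℕ) (s : ℚ) (s>0 : 0ℚ < s) (g : Subset n → ℚ) where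

  private instance
    s-positive : Positive s
    s-positive = positive s>0

    s-nonZero : NonZero s
    s-nonZero = QP.pos⇒nonZero s

  private
    1/s≥0 : 0ℚ ≤ 1/ s
    1/s≥0 = QP.nonNegative⁻¹ (1/ s) {{QP.pos⇒nonNeg (1/ s) {{QP.1/pos⇒pos s}}}}

  scaled : Subset n → ℚ
  scaled S = 1/ s * g S

  scaled-packing : (∀ S → 0ℚ ≤ g S) → (∀ S → g S ≢ 0ℚ → IsClique G r S) →
    (∀ x y → x ≢ y → G x y ≡ true → edgeLoad g x y ≤ s) → IsFracPacking G r scaled
  scaled-packing g≥0 g-clique g-load =
    (λ S → *-nonNeg 1/s≥0 (g≥0 S)) ,
    (λ S scaled≢0 → g-clique S (*≢0ʳ (1/ s) (g S) scaled≢0)) ,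
    (λ x y x≢y Gxy → begin
      edgeLoad scaled x y   ≡⟨ weight-*ˡ (covers x y) (1/ s) g ⟩
      1/ s * edgeLoad g x y ≤⟨ QP.*-monoˡ-≤-nonNeg (1/ s) {{nonNegative 1/s≥0}} (g-load x y x≢y Gxy) ⟩
      1/ s * s              ≡⟨ QP.*-inverseˡ s ⟩
      1ℚ                    ∎)
    where open QP.≤-Reasoning

  scaled-value : s * packingValue scaled ≡ packingValue g
  scaled-value = begin
    s * packingValue scaled    ≡⟨ cong (s *_) (weight-*ˡ (λ _ → true) (1/ s) g) ⟩
    s * (1/ s * packingValue g) ≡⟨ sym (QP.*-assoc s (1/ s) _) ⟩
    (s * 1/ s) * packingValue g ≡⟨ cong (_* packingValue g) (QP.*-inverseʳ s) ⟩
    1ℚ * packingValue g        ≡⟨ QP.*-identityˡ _ ⟩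
    packingValue g             ∎
    where open ≡-Reasoning

-- Counting edges

ℕtoℚ≡mkℚ : ∀ k → ℕtoℚ k ≡ mkℚ (ℤ.+ k) 0 (Coprime.sym (Coprime.1-coprimeTo k))
ℕtoℚ≡mkℚ k = QP.normalize-coprime _

ℕtoℚ-+ : ∀ m k → ℕtoℚ (m N.+ k) ≡ ℕtoℚ m + ℕtoℚ k
ℕtoℚ-+ m k rewrite ℕtoℚ≡mkℚ m | ℕtoℚ≡mkℚ k =
  QP./-cong {ℤ.+ (m N.+ k)} {1} {ℤ.+ m ℤ.* ℤ.+ 1 ℤ.+ ℤ.+ k ℤ.* ℤ.+ 1} {1 N.* 1}
    (cong₂ ℤ._+_ (sym (ℤP.*-identityʳ (ℤ.+ m))) (sym (ℤP.*-identityʳ (ℤ.+ k)))) refl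

ℕtoℚ-sum-map : ∀ (L : List A) h → ℕtoℚ (sumℕ (map h L)) ≡ ∑[ a ← L ] ℕtoℚ (h a)
ℕtoℚ-sum-map [] h = refl
ℕtoℚ-sum-map (a ∷ L) h = trans (ℕtoℚ-+ (h a) _) (cong (ℕtoℚ (h a) +_) (ℕtoℚ-sum-map L h))

ℕtoℚ-sum-concatMap : ∀ (L : List A) F → ℕtoℚ (sumℕ (concatMap F L)) ≡ ∑[ a ← L ] ℕtoℚ (sumℕ (F a))
ℕtoℚ-sum-concatMap [] F = refl
ℕtoℚ-sum-concatMap (a ∷ L) F = trans (cong ℕtoℚ (sumℕ-++ (F a) (concatMap F L)))
  (trans (ℕtoℚ-+ (sumℕ (F a)) _) (cong (ℕtoℚ (sumℕ (F a)) +_) (ℕtoℚ-sum-concatMap L F)))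

ℕtoℚ-b2ℕ : ∀ b → ℕtoℚ (b2ℕ b) ≡ ind b 1ℚ
ℕtoℚ-b2ℕ true = refl
ℕtoℚ-b2ℕ false = refl

module _ {n : ℕ} where

  lt-true : ∀ {x y : Fin n} → x F.< y → lt x y ≡ true
  lt-true {x} {y} x<y with x F.<? y
  ... | yes _ = refl
  ... | no x≮y = ⊥-elim (x≮y x<y)

  lt-false : ∀ {x y : Fin n} → ¬ (x F.< y) → lt x y ≡ false
  lt-false {x} {y} x≮y with x F.<? y
  ... | yes x<y = ⊥-elim (x≮y x<y)
  ... | no _ = refl

  edgeCount-∑ : ∀ H → ℕtoℚ (edgeCount H) ≡ ∑[ x ← allFin n ] ∑[ y ← allFin n ] ind (lt x y ∧ H x y) 1ℚ
  edgeCount-∑ H = trans (ℕtoℚ-sum-concatMap (allFin n) _) (∑-cong (allFin n) (λ x →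
    trans (ℕtoℚ-sum-map (allFin n) _) (∑-cong (allFin n) (λ y → ℕtoℚ-b2ℕ (lt x y ∧ H x y)))))

  degreeSum : Adj n → ℚ
  degreeSum H = ∑[ x ← allFin n ] ∑[ y ← allFin n ] ind (H x y) 1ℚ

  handshake : ∀ H → IsSimpleGraph H → degreeSum H ≡ ℕtoℚ (edgeCount H) + ℕtoℚ (edgeCount H)
  handshake H (H-sym , H-irrefl) = begin
    degreeSum H
      ≡⟨ ∑-cong (allFin n) (λ x → ∑-cong (allFin n) (λ y → by-order x y)) ⟩
    ∑[ x ← allFin n ] ∑[ y ← allFin n ] (ind (lt x y ∧ H x y) 1ℚ + ind (lt y x ∧ H y x) 1ℚ)
      ≡⟨ trans (∑-cong (allFin n) (λ x → ∑-+ (allFin n) _ _)) (∑-+ (allFin n) _ _) ⟩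
    E + ∑[ x ← allFin n ] ∑[ y ← allFin n ] ind (lt y x ∧ H y x) 1ℚ
      ≡⟨ cong (E +_) (∑-comm (allFin n) (allFin n) _) ⟩
    E + E
      ≡⟨ sym (cong₂ _+_ (edgeCount-∑ H) (edgeCount-∑ H)) ⟩
    ℕtoℚ (edgeCount H) + ℕtoℚ (edgeCount H) ∎
    where
    open ≡-Reasoning
    E = ∑[ x ← allFin n ] ∑[ y ← allFin n ] ind (lt x y ∧ H x y) 1ℚ
    by-order : ∀ x y → ind (H x y) 1ℚ ≡ ind (lt x y ∧ H x y) 1ℚ + ind (lt y x ∧ H y x) 1ℚ
    by-order x y with FP.<-cmp x y
    ... | tri< x<y _ y≮x rewrite lt-true x<y | lt-false y≮x = sym (QP.+-identityʳ _)
    ... | tri> x≮y _ y<x rewrite lt-false x≮y | lt-true y<x | H-sym y x = sym (QP.+-identityˡ _)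
    ... | tri≈ x≮y refl _ rewrite lt-false x≮y | H-irrefl x = refl

  ∑-split : ∀ (W : Subset n) f → ∑ (allFin n) f ≡
    ∑[ x ← allFin n ] ind (not (lookup W x)) (f x) + ∑[ x ← allFin n ] ind (lookup W x) (f x)
  ∑-split W f = trans (∑-cong (allFin n) (λ x → by-membership (lookup W x) (f x))) (∑-+ (allFin n) _ _)
    where
    by-membership : ∀ b q → q ≡ ind (not b) q + ind b q
    by-membership true q = sym (QP.+-identityˡ q)
    by-membership false q = sym (QP.+-identityʳ q)

  outDegree : Subset n → Adj n → Fin n → ℚ
  outDegree W H x = ∑[ y ← allFin n ] ind (not (lookup W y)) (ind (H x y) 1ℚ)

  degreeSumOutside : Subset n → Adj n → ℚ
  degreeSumOutside W H = ∑[ x ← allFin n ] ind (not (lookup W x)) (outDegree W H x)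

  crossEdges : Subset n → Adj n → ℚ
  crossEdges W H = ∑[ x ← allFin n ] ind (lookup W x) (outDegree W H x)

  degreeSum-split : ∀ W H → (∀ x y → H x y ≡ H y x) →
    (∀ {x y} → lookup W x ≡ true → lookup W y ≡ true → H x y ≡ false) →
    degreeSum H ≡ degreeSumOutside W H + (crossEdges W H + crossEdges W H)
  degreeSum-split W H H-sym W-indep = begin
    degreeSum H
      ≡⟨ ∑-split W degree ⟩
    ∑[ x ← allFin n ] ind (not (lookup W x)) (degree x) + ∑[ x ← allFin n ] ind (lookup W x) (degree x)
      ≡⟨ cong₂ _+_ outer inner ⟩
    (degreeSumOutside W H + crossEdges W H) + crossEdges W H
      ≡⟨ QP.+-assoc (degreeSumOutside W H) (crossEdges W H) (crossEdges W H) ⟩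
    degreeSumOutside W H + (crossEdges W H + crossEdges W H) ∎
    where
    open ≡-Reasoning
    degree inDegree : Fin n → ℚ
    degree x = ∑[ y ← allFin n ] ind (H x y) 1ℚ
    inDegree x = ∑[ y ← allFin n ] ind (lookup W y) (ind (H x y) 1ℚ)
    inner : ∑[ x ← allFin n ] ind (lookup W x) (degree x) ≡ crossEdges W H
    inner = ∑-cong (allFin n) (λ x → ind-cong (lookup W x) (λ x∈W →
      trans (∑-split W _) (trans (cong (outDegree W H x +_) (∑-zero (allFin n) (λ y →
        ind-zero (lookup W y) (λ y∈W → cong (λ b → ind b 1ℚ) (W-indep x∈W y∈W)))))
        (QP.+-identityʳ _))))
    crossing : ∑[ x ← allFin n ] ind (not (lookup W x)) (inDegree x) ≡ crossEdges W H
    crossing = begin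
      ∑[ x ← allFin n ] ind (not (lookup W x)) (inDegree x)
        ≡⟨ ∑-cong (allFin n) (λ x → ind-∑ (not (lookup W x)) (allFin n) _) ⟩
      ∑[ x ← allFin n ] ∑[ y ← allFin n ] ind (not (lookup W x)) (ind (lookup W y) (ind (H x y) 1ℚ))
        ≡⟨ ∑-comm (allFin n) (allFin n) _ ⟩
      ∑[ y ← allFin n ] ∑[ x ← allFin n ] ind (not (lookup W x)) (ind (lookup W y) (ind (H x y) 1ℚ))
        ≡⟨ ∑-cong (allFin n) (λ y → ∑-cong (allFin n) (λ x →
             trans (ind-comm (not (lookup W x)) (lookup W y) _)
                   (cong (λ b → ind (lookup W y) (ind (not (lookup W x)) (ind b 1ℚ))) (H-sym x y)))) ⟩
      ∑[ y ← allFin n ] ∑[ x ← allFin n ] ind (lookup W y) (ind (not (lookup W x)) (ind (H y x) 1ℚ))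
        ≡⟨ ∑-cong (allFin n) (λ y → sym (ind-∑ (lookup W y) (allFin n) _)) ⟩
      crossEdges W H ∎
    outer : ∑[ x ← allFin n ] ind (not (lookup W x)) (degree x) ≡ degreeSumOutside W H + crossEdges W H
    outer = trans (∑-cong (allFin n) (λ x →
              trans (cong (ind (not (lookup W x))) (∑-split W _)) (ind-+ (not (lookup W x)) _ _)))
            (trans (∑-+ (allFin n) _ _) (cong (degreeSumOutside W H +_) crossing))

module _ {n} (G : Adj n) (W : Subset n) (z : Fin n) where

  outDegree-transfer-outside : ∀ {x} → lookup W x ≡ false → outDegree W (transfer G W z) x ≡ outDegree W G x
  outDegree-transfer-outside x∉W = ∑-cong (allFin n) (λ y → ind-cong (not (lookup W y)) (λ y∉W →
    cong (λ b → ind b 1ℚ) (transfer-outside G W z x∉W (not-injective y∉W))))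

  outDegree-transfer-inside : ∀ {x} → lookup W x ≡ true → outDegree W (transfer G W z) x ≡ outDegree W G z
  outDegree-transfer-inside x∈W = ∑-cong (allFin n) (λ y → ind-cong (not (lookup W y)) (λ y∉W →
    cong (λ b → ind b 1ℚ) (transfer-leaving G W z x∈W (not-injective y∉W))))

  degreeSumOutside-transfer : degreeSumOutside W (transfer G W z) ≡ degreeSumOutside W G
  degreeSumOutside-transfer = ∑-cong (allFin n) (λ x → ind-cong (not (lookup W x)) (λ x∉W →
    outDegree-transfer-outside (not-injective x∉W)))

  crossEdges-transfer : crossEdges W (transfer G W z) ≡ size W * outDegree W G z
  crossEdges-transfer = trans (∑-cong (allFin n) (λ x → ind-cong (lookup W x) outDegree-transfer-inside))
    (∑-ind-const W _)

module Averaging {n} (G : Adj n) (G-simple : IsSimpleGraph G) (V₀ V₁ : Subset n)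
  (V₀∩V₁=∅ : ∀ x → x ∈ V₀ → x ∉ V₁)
  (clones₀ : ∀ u v → u ∈ V₀ → v ∈ V₀ → Clones G u v)
  (clones₁ : ∀ u v → u ∈ V₁ → v ∈ V₁ → Clones G u v)
  (W-indep : ∀ x y → x ∈ (V₀ ∪ V₁) → y ∈ (V₀ ∪ V₁) → G x y ≡ false)
  {z₀ z₁ : Fin n} (z₀∈V₀ : z₀ ∈ V₀) (z₁∈V₁ : z₁ ∈ V₁) where

  W : Subset n
  W = V₀ ∪ V₁

  private
    G-sym : ∀ x y → G x y ≡ G y x
    G-sym = proj₁ G-simple

    lookup-W : ∀ x → lookup W x ≡ lookup V₀ x ∨ lookup V₁ x
    lookup-W x = VP.lookup-zipWith _∨_ x V₀ V₁

    V₀⊆W : ∀ {v} → lookup V₀ v ≡ true → lookup W v ≡ true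
    V₀⊆W {v} v∈V₀ rewrite lookup-W v | v∈V₀ = refl

    V₁⊆W : ∀ {v} → lookup V₁ v ≡ true → lookup W v ≡ true
    V₁⊆W {v} v∈V₁ rewrite lookup-W v | v∈V₁ = ∨-zeroʳ (lookup V₀ v)

    V₀~z₀ : ∀ {v} → lookup V₀ v ≡ true → ∀ y → G v y ≡ G z₀ y
    V₀~z₀ {v} v∈V₀ = proj₂ (clones₀ v z₀ (VP.lookup⇒[]= v V₀ v∈V₀) z₀∈V₀)

    V₁~z₁ : ∀ {v} → lookup V₁ v ≡ true → ∀ y → G v y ≡ G z₁ y
    V₁~z₁ {v} v∈V₁ = proj₂ (clones₁ v z₁ (VP.lookup⇒[]= v V₁ v∈V₁) z₁∈V₁)

    G-W-indep : ∀ {x y} → lookup W x ≡ true → lookup W y ≡ true → G x y ≡ false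
    G-W-indep {x} {y} x∈W y∈W = W-indep x y (VP.lookup⇒[]= x W x∈W) (VP.lookup⇒[]= y W y∈W)

    ind-W : ∀ x q → ind (lookup W x) q ≡ ind (lookup V₀ x) q + ind (lookup V₁ x) q
    ind-W x q rewrite lookup-W x with lookup V₀ x in x∈V₀ | lookup V₁ x in x∈V₁
    ... | true | true = ⊥-elim (V₀∩V₁=∅ x (VP.lookup⇒[]= x V₀ x∈V₀) (VP.lookup⇒[]= x V₁ x∈V₁))
    ... | true | false = sym (QP.+-identityʳ q)
    ... | false | true = sym (QP.+-identityˡ q)
    ... | false | false = refl

  size-W : size W ≡ size V₀ + size V₁
  size-W = trans (∑-cong (allFin n) (λ x → ind-W x 1ℚ)) (∑-+ (allFin n) _ _)

  size-W-positive : 0ℚ < size W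
  size-W-positive = begin-strict
    0ℚ                    <⟨ QP.positive⁻¹ 1ℚ ⟩
    1ℚ                    ≡⟨ cong (λ b → ind b 1ℚ) (sym (VP.[]=⇒lookup z₀∈V₀)) ⟩
    ind (lookup V₀ z₀) 1ℚ ≤⟨ term≤∑ F._≟_ (allFin n) (allFin-enumerates n)
                               (λ x → ind-nonNeg (lookup V₀ x) (QP.nonNegative⁻¹ 1ℚ)) z₀ ⟩
    size V₀               ≤⟨ QP.≤-trans (QP.≤-reflexive (sym (QP.+-identityʳ (size V₀))))
                               (QP.+-monoʳ-≤ (size V₀) (size-nonNeg V₁)) ⟩
    size V₀ + size V₁     ≡⟨ sym size-W ⟩
    size W                ∎
    where open QP.≤-Reasoning

  crossEdges-G : crossEdges W G ≡ size V₀ * outDegree W G z₀ + size V₁ * outDegree W G z₁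
  crossEdges-G = trans (∑-cong (allFin n) (λ x → ind-W x (outDegree W G x)))
    (trans (∑-+ (allFin n) _ _) (cong₂ _+_ (clone-class V₀ V₀~z₀) (clone-class V₁ V₁~z₁)))
    where
    clone-class : ∀ V {z} → (∀ {v} → lookup V v ≡ true → ∀ y → G v y ≡ G z y) →
      ∑[ x ← allFin n ] ind (lookup V x) (outDegree W G x) ≡ size V * outDegree W G z
    clone-class V V~z = trans (∑-cong (allFin n) (λ x → ind-cong (lookup V x) (λ x∈V →
      ∑-cong (allFin n) (λ y → cong (λ b → ind (not (lookup W y)) (ind b 1ℚ)) (V~z x∈V y)))))
      (∑-ind-const V _)

  degreeSum-transfer : ∀ z → degreeSum (transfer G W z) ≡
    degreeSumOutside W G + (size W * outDegree W G z + size W * outDegree W G z)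
  degreeSum-transfer z = trans
    (degreeSum-split W (transfer G W z) (proj₁ (transfer-simple G-simple W z)) (transfer-inside G W z))
    (cong₂ (λ X C → X + (C + C)) (degreeSumOutside-transfer G W z) (crossEdges-transfer G W z))

  degreeSum-average : size W * degreeSum G ≡
    size V₁ * degreeSum (transfer G W z₁) + size V₀ * degreeSum (transfer G W z₀)
  degreeSum-average = begin
    s * degreeSum G
      ≡⟨ cong₂ _*_ size-W (trans (degreeSum-split W G G-sym G-W-indep) (cong (λ C → X + (C + C)) crossEdges-G)) ⟩
    (a + b) * (X + ((a * D₀ + b * D₁) + (a * D₀ + b * D₁)))
      ≡⟨ solve 5 (λ a b X D₀ D₁ →
           (a :+ b) :* (X :+ ((a :* D₀ :+ b :* D₁) :+ (a :* D₀ :+ b :* D₁))) :=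
           b :* (X :+ ((a :+ b) :* D₁ :+ (a :+ b) :* D₁)) :+ a :* (X :+ ((a :+ b) :* D₀ :+ (a :+ b) :* D₀)))
           refl a b X D₀ D₁ ⟩
    b * (X + ((a + b) * D₁ + (a + b) * D₁)) + a * (X + ((a + b) * D₀ + (a + b) * D₀))
      ≡⟨ cong (λ t → b * (X + (t * D₁ + t * D₁)) + a * (X + (t * D₀ + t * D₀))) (sym size-W) ⟩
    b * (X + (s * D₁ + s * D₁)) + a * (X + (s * D₀ + s * D₀))
      ≡⟨ sym (cong₂ (λ d₁ d₀ → b * d₁ + a * d₀) (degreeSum-transfer z₁) (degreeSum-transfer z₀)) ⟩
    b * degreeSum (transfer G W z₁) + a * degreeSum (transfer G W z₀) ∎
    where
    open ≡-Reasoning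
    open +-*-Solver
    s = size W
    a = size V₀
    b = size V₁
    X = degreeSumOutside W G
    D₀ = outDegree W G z₀
    D₁ = outDegree W G z₁

  edgeCount-average : size W * ℕtoℚ (edgeCount G) ≡
    size V₁ * ℕtoℚ (edgeCount (transfer G W z₁)) + size V₀ * ℕtoℚ (edgeCount (transfer G W z₀))
  edgeCount-average = p+p≡q+q⇒p≡q (begin
    s * e + s * e                          ≡⟨ sym (QP.*-distribˡ-+ s e e) ⟩
    s * (e + e)                            ≡⟨ cong (s *_) (sym (handshake G G-simple)) ⟩
    s * degreeSum G                        ≡⟨ degreeSum-average ⟩
    b * degreeSum G₀₁ + a * degreeSum G₁₀  ≡⟨ cong₂ (λ d₁ d₀ → b * d₁ + a * d₀)
                                                (handshake G₀₁ (transfer-simple G-simple W z₁))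
                                                (handshake G₁₀ (transfer-simple G-simple W z₀)) ⟩
    b * (e₁ + e₁) + a * (e₀ + e₀)          ≡⟨ solve 4 (λ a b e₀ e₁ →
                                                b :* (e₁ :+ e₁) :+ a :* (e₀ :+ e₀) :=
                                                (b :* e₁ :+ a :* e₀) :+ (b :* e₁ :+ a :* e₀))
                                                refl a b e₀ e₁ ⟩
    (b * e₁ + a * e₀) + (b * e₁ + a * e₀)  ∎)
    where
    open ≡-Reasoning
    open +-*-Solver
    s = size W
    a = size V₀
    b = size V₁
    G₀₁ = transfer G W z₁
    G₁₀ = transfer G W z₀
    e = ℕtoℚ (edgeCount G)
    e₀ = ℕtoℚ (edgeCount G₁₀)
    e₁ = ℕtoℚ (edgeCount G₀₁)

  module Combination {r} {f₀₁ f₁₀ : Subset n → ℚ}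
    (f₀₁-packing : IsFracPacking (transfer G W z₁) r f₀₁)
    (f₁₀-packing : IsFracPacking (transfer G W z₀) r f₁₀) where

    private
      module G₀₁ = TransferredPacking G G-sym W z₁ f₀₁-packing
      module G₁₀ = TransferredPacking G G-sym W z₀ f₁₀-packing
      module B₁ = G₀₁.Pullback V₁ V₁⊆W V₁~z₁
      module B₀ = G₁₀.Pullback V₀ V₀⊆W V₀~z₀

    combined : Subset n → ℚ
    combined S = B₁.pullback S + B₀.pullback S

    weight-combined : ∀ {P} → G₀₁.SwapInvariant P →
      weight P combined ≡ size V₁ * weight P f₀₁ + size V₀ * weight P f₁₀
    weight-combined {P} P-inv =
      trans (weight-+ P B₁.pullback B₀.pullback) (cong₂ _+_ (B₁.weight-pullback P-inv) (B₀.weight-pullback P-inv))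

    crossing-load : ∀ {p q} → lookup W p ≡ true → lookup W q ≡ false → G p q ≡ true →
      edgeLoad combined p q ≤ size W
    crossing-load {p} {q} p∈W q∉W Gpq = begin
      edgeLoad combined p q
        ≡⟨ weight-+ (covers p q) B₁.pullback B₀.pullback ⟩
      edgeLoad B₁.pullback p q + edgeLoad B₀.pullback p q
        ≤⟨ QP.+-mono-≤ (B₁.pullback-load p∈W q∉W Gpq) (B₀.pullback-load p∈W q∉W Gpq) ⟩
      ind (lookup V₁ p) (size W) + ind (lookup V₀ p) (size W)
        ≡⟨ trans (QP.+-comm (ind (lookup V₁ p) (size W)) _) (sym (ind-W p (size W))) ⟩
      ind (lookup W p) (size W)
        ≡⟨ cong (λ b → ind b (size W)) p∈W ⟩
      size W ∎
      where open QP.≤-Reasoning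

    combined-load : ∀ p q → p ≢ q → G p q ≡ true → edgeLoad combined p q ≤ size W
    combined-load p q p≢q Gpq with lookup W p in p∈W | lookup W q in q∈W
    ... | true | true with () ← trans (sym Gpq) (G-W-indep p∈W q∈W)
    ... | true | false = crossing-load p∈W q∈W Gpq
    ... | false | true = QP.≤-trans
      (QP.≤-reflexive (weight-congˡ combined (λ S → ∧-comm (lookup S p) (lookup S q))))
      (crossing-load q∈W p∈W (trans (G-sym q p) Gpq))
    ... | false | false = begin
      edgeLoad combined p q
        ≡⟨ weight-combined outside-edge ⟩
      size V₁ * edgeLoad f₀₁ p q + size V₀ * edgeLoad f₁₀ p q
        ≤⟨ QP.+-mono-≤
             (QP.*-monoˡ-≤-nonNeg (size V₁) {{nonNegative (size-nonNeg V₁)}}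
               (proj₂ (proj₂ f₀₁-packing) p q p≢q (trans (transfer-outside G W z₁ p∈W q∈W) Gpq)))
             (QP.*-monoˡ-≤-nonNeg (size V₀) {{nonNegative (size-nonNeg V₀)}}
               (proj₂ (proj₂ f₁₀-packing) p q p≢q (trans (transfer-outside G W z₀ p∈W q∈W) Gpq))) ⟩
      size V₁ * 1ℚ + size V₀ * 1ℚ
        ≡⟨ trans (cong₂ _+_ (QP.*-identityʳ (size V₁)) (QP.*-identityʳ (size V₀)))
             (trans (QP.+-comm (size V₁) (size V₀)) (sym size-W)) ⟩
      size W ∎
      where
      open QP.≤-Reasoning
      outside-edge : G₀₁.SwapInvariant (covers p q)
      outside-edge x∈W v∈W S = cong₂ _∧_
        (lookup-swap-other _ _ S (lookup-≢ W p∈W x∈W) (lookup-≢ W p∈W v∈W))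
        (lookup-swap-other _ _ S (lookup-≢ W q∈W x∈W) (lookup-≢ W q∈W v∈W))

    combined-nonNeg : ∀ S → 0ℚ ≤ combined S
    combined-nonNeg S = QP.+-mono-≤ (B₁.pullback-nonNeg S) (B₀.pullback-nonNeg S)

    combined-clique : ∀ S → combined S ≢ 0ℚ → IsClique G r S
    combined-clique S combined≢0 with +≢0 _ _ combined≢0
    ... | inj₁ pullback₁≢0 = B₁.pullback-clique S pullback₁≢0
    ... | inj₂ pullback₀≢0 = B₀.pullback-clique S pullback₀≢0

    private
      module A = Scaled G r (size W) size-W-positive combined

    averaged : Subset n → ℚ
    averaged = A.scaled

    averaged-packing : IsFracPacking G r averaged
    averaged-packing = A.scaled-packing combined-nonNeg combined-clique combined-load

    h-average : ∀ c →
      size V₁ * h (transfer G W z₁) c (packingValue f₀₁) + size V₀ * h (transfer G W z₀) c (packingValue f₁₀)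
        ≡ size W * h G c (packingValue averaged)
    h-average c = begin
      b * (ν₁ + c * e₁) + a * (ν₀ + c * e₀)     ≡⟨ solve 7 (λ a b c ν₀ ν₁ e₀ e₁ →
                                                     b :* (ν₁ :+ c :* e₁) :+ a :* (ν₀ :+ c :* e₀) :=
                                                     (b :* ν₁ :+ a :* ν₀) :+ c :* (b :* e₁ :+ a :* e₀))
                                                     refl a b c ν₀ ν₁ e₀ e₁ ⟩
      (b * ν₁ + a * ν₀) + c * (b * e₁ + a * e₀) ≡⟨ cong₂ (λ ν e → ν + c * e)
                                                     (sym (trans A.scaled-value (weight-combined (λ _ _ _ → refl))))
                                                     (sym edgeCount-average) ⟩
      s * ν + c * (s * e)                       ≡⟨ solve 4 (λ s ν c e → s :* ν :+ c :* (s :* e) := s :* (ν :+ c :* e))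
                                                     refl s ν c e ⟩
      s * (ν + c * e)                           ∎
      where
      open ≡-Reasoning
      open +-*-Solver
      s = size W
      a = size V₀
      b = size V₁
      ν = packingValue averaged
      ν₀ = packingValue f₁₀
      ν₁ = packingValue f₀₁
      e = ℕtoℚ (edgeCount G)
      e₀ = ℕtoℚ (edgeCount (transfer G W z₀))
      e₁ = ℕtoℚ (edgeCount (transfer G W z₁))

lemma2p1 : (n r : ℕ) → r ≥ 3 → (c : ℚ) → (G : Adj n) → IsSimpleGraph G →
    (V₀ V₁ : Subset n) → Nonempty V₀ → Nonempty V₁ →
    (∀ x → x ∈ V₀ → x ∉ V₁) →
    (∀ u v → u ∈ V₀ → v ∈ V₀ → Clones G u v) →
    (∀ u v → u ∈ V₁ → v ∈ V₁ → Clones G u v) →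
    (∀ x y → x ∈ (V₀ ∪ V₁) → y ∈ (V₀ ∪ V₁) → G x y ≡ false) →
    (z₀ z₁ : Fin n) → z₀ ∈ V₀ → z₁ ∈ V₁ →
    (ν ν₀₁ ν₁₀ : ℚ) →
    IsNuStar G r ν →
    IsNuStar (transfer G (V₀ ∪ V₁) z₁) r ν₀₁ →
    IsNuStar (transfer G (V₀ ∪ V₁) z₀) r ν₁₀ →
    (h (transfer G (V₀ ∪ V₁) z₁) c ν₀₁ ⊓ h (transfer G (V₀ ∪ V₁) z₀) c ν₁₀) ≤ h G c ν
lemma2p1 n r _ c G G-simple V₀ V₁ _ _ V₀∩V₁=∅ clones₀ clones₁ W-indep z₀ z₁ z₀∈V₀ z₁∈V₁ ν _ _
  (_ , ν-max) ((f₀₁ , f₀₁-packing , refl) , _) ((f₁₀ , f₁₀-packing , refl) , _) =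
  QP.*-cancelˡ-≤-pos (size W) {{positive size-W-positive}} (begin
    size W * (h₀₁ ⊓ h₁₀)
      ≡⟨ cong (_* (h₀₁ ⊓ h₁₀)) (trans size-W (QP.+-comm (size V₀) (size V₁))) ⟩
    (size V₁ + size V₀) * (h₀₁ ⊓ h₁₀)
      ≤⟨ [p+q]*[x⊓y]≤p*x+q*y (size-nonNeg V₁) (size-nonNeg V₀) h₀₁ h₁₀ ⟩
    size V₁ * h₀₁ + size V₀ * h₁₀
      ≡⟨ h-average c ⟩
    size W * h G c (packingValue averaged)
      ≤⟨ QP.*-monoˡ-≤-nonNeg (size W) {{nonNegative (size-nonNeg W)}}
           (QP.+-monoˡ-≤ _ (ν-max averaged averaged-packing)) ⟩
    size W * h G c ν ∎)
  where
  open Averaging G G-simple V₀ V₁ V₀∩V₁=∅ clones₀ clones₁ W-indep z₀∈V₀ z₁∈V₁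
  open Combination f₀₁-packing f₁₀-packing
  open QP.≤-Reasoning
  h₀₁ = h (transfer G W z₁) c (packingValue f₀₁)
  h₁₀ = h (transfer G W z₀) c (packingValue f₁₀)
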